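{- Let $T$ be a (labeled) rooted tree with at least two vertices and $N$ vertices in total, equipped with a $j$-numbering. Consider the recursive procedure $\mathrm{hasNiceAutomorphism}(T,r)$ with $r$ the root: for each class of children of $r$ sharing the same $j$-number, let $k$ be the size of the class; if $k$ is odd, pick a child $v$ in the class; if $v$ is a leaf, return false; otherwise, if $\mathrm{hasNiceAutomorphism}(T_v,v)$ returns false, return false. If no class causes a return of false, return true. Then this procedure returns true if and only if $T$ admits an automorphism whose restriction to the set of leaves is a fixed-point-free involution, and its running time is $O(N^2)$.
   Context: An automorphism of a labeled rooted tree is a bijection of its vertex set preserving adjacency, fixing the root and preserving labels. $T_v$ denotes the subtree of $T$ rooted at $v$ (consisting of $v$ and its descendants). A $j$-numbering of $T$ is an assignment of integers to the vertices of $T$ (computable in linear time, following Colbourn and Booth) such that two vertices at the same depth receive the same $j$-number if and only if they lie in the same orbit of the automorphism group of $T$. A permutation $\sigma$ of the leaves is a fixed-point-free involution if $\sigma^2=\mathrm{id}$ and $\sigma(x)\neq x$ for every leaf $x$. -}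

module Defs where

open import Data.Nat using (ℕ; zero; suc; _+_; _*_; _%_)
open import Data.Integer using (ℤ)
import Data.Integer as ℤ
open import Data.Bool using (Bool; true; false; if_then_else_; not)
open import Data.List using (List; []; _∷_; length; filter)
open import Data.List.Membership.DecPropositional ℤ._≟_ using (_∈?_)
open import Data.Maybe using (Maybe; just; nothing; maybe)
import Data.Maybe as Maybe
open import Data.Sum using (_⊎_)
open import Data.Product using (_×_)
open import Relation.Binary.PropositionalEquality using (_≡_; _≢_)
open import Relation.Nullary.Decidable using (⌊_⌋)
open import Function using (_∘_)
open import Function.Bundles using (_⇔_)

-- Labeled rooted trees (finite, ordered child lists; order is irrelevant
-- for everything below, since automorphisms may permute children).

data Tree (L : Set) : Set where
  node : L → List (Tree L) → Tree L

module _ {L : Set} where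

  -- Vertices of a tree: positions.  'root' is the root, 'sub q' a vertex
  -- inside one of the child subtrees.
  data Pos : Tree L → Set
  data PosL : List (Tree L) → Set

  data Pos where
    root : ∀ {t} → Pos t
    sub  : ∀ {l ts} → PosL ts → Pos (node l ts)

  data PosL where
    hd : ∀ {t ts} → Pos t → PosL (t ∷ ts)
    tl : ∀ {t ts} → PosL ts → PosL (t ∷ ts)

  size  : Tree L → ℕ
  sizeL : List (Tree L) → ℕ
  size (node _ ts) = suc (sizeL ts)
  sizeL [] = 0
  sizeL (t ∷ ts) = size t + sizeL ts

  parent  : ∀ {t} → Pos t → Maybe (Pos t)
  parentL : ∀ {ts} → PosL ts → Maybe (PosL ts)
  parent root = nothing
  parent (sub q) = just (maybe sub root (parentL q))
  parentL (hd p) = Maybe.map hd (parent p)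
  parentL (tl q) = Maybe.map tl (parentL q)

  Adj : ∀ {t} → Pos t → Pos t → Set
  Adj p q = parent p ≡ just q ⊎ parent q ≡ just p

  label  : ∀ {t} → Pos t → L
  labelL : ∀ {ts} → PosL ts → L
  label {node l _} root = l
  label (sub q) = labelL q
  labelL (hd p) = label p
  labelL (tl q) = labelL q

  depth  : ∀ {t} → Pos t → ℕ
  depthL : ∀ {ts} → PosL ts → ℕ
  depth root = 0
  depth (sub q) = suc (depthL q)
  depthL (hd p) = depth p
  depthL (tl q) = depthL q

  IsLeaf : ∀ {t} → Pos t → Set
  IsLeaf {t} p = ∀ (q : Pos t) → parent q ≢ just p

  record Automorphism (t : Tree L) : Set where
    field
      fun        : Pos t → Pos t
      inv        : Pos t → Pos t
      inv-fun    : ∀ p → inv (fun p) ≡ p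
      fun-inv    : ∀ p → fun (inv p) ≡ p
      adj-pres   : ∀ p q → Adj p q ⇔ Adj (fun p) (fun q)
      root-fixed : fun root ≡ root
      label-pres : ∀ p → label (fun p) ≡ label p

  open Automorphism public

  NiceOnLeaves : ∀ {t} → Automorphism t → Set
  NiceOnLeaves {t} σ =
    ∀ (p : Pos t) → IsLeaf p → (fun σ (fun σ p) ≡ p) × (fun σ p ≢ p)

  IsJNumbering : (t : Tree L) → (Pos t → ℤ) → Set
  IsJNumbering t j =
    ∀ (p q : Pos t) → depth p ≡ depth q →
      (j p ≡ j q) ⇔ (Data.Product.Σ (Automorphism t) λ σ → fun σ p ≡ q)

  isLeafTree : Tree L → Bool
  isLeafTree (node _ []) = true
  isLeafTree (node _ (_ ∷ _)) = false

  isOdd : ℕ → Bool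
  isOdd n = ⌊ n % 2 Data.Nat.≟ 1 ⌋

  count : ℤ → List ℤ → ℕ
  count x xs = length (filter (ℤ._≟ x) xs)

  childJs : (ts : List (Tree L)) → (PosL ts → ℤ) → List ℤ
  childJs [] f = []
  childJs (t ∷ ts) f = f (hd root) ∷ childJs ts (f ∘ tl)

  hasNiceAutomorphism : (t : Tree L) → (Pos t → ℤ) → Bool
  -- walk over the children; 'all' = j-numbers of all children,
  -- 'seen' = j-numbers of classes already handled.  For each class the
  -- first child of the class is the picked representative v.
  walk : (ts : List (Tree L)) → (PosL ts → ℤ) → List ℤ → List ℤ → Bool

  hasNiceAutomorphism (node _ ts) j =
    walk ts (j ∘ sub) (childJs ts (j ∘ sub)) []

  walk [] f all seen = true
  walk (c ∷ cs) f all seen =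
    if ⌊ f (hd root) ∈? seen ⌋
    then walk cs (f ∘ tl) all seen
    else (if isOdd (count (f (hd root)) all)
          then (if isLeafTree c then false
                else (if hasNiceAutomorphism c (f ∘ hd)
                      then walk cs (f ∘ tl) all (f (hd root) ∷ seen)
                      else false))
          else walk cs (f ∘ tl) all (f (hd root) ∷ seen))

  -- Cost model (number of elementary steps) of the procedure above:
  -- one step per call and per child, plus a linear scan of 'seen'
  -- (membership) and of 'all' (counting) for each child, plus the cost
  -- of the recursive call when it is made.  Early returns are ignored
  -- (the traversal is charged fully), which only over-approximates.

  cost     : (t : Tree L) → (Pos t → ℤ) → ℕ
  walkCost : (ts : List (Tree L)) → (PosL ts → ℤ) → List ℤ → List ℤ → ℕ

  cost (node _ ts) j =
    suc (length ts + walkCost ts (j ∘ sub) (childJs ts (j ∘ sub)) [])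

  walkCost [] f all seen = 1
  walkCost (c ∷ cs) f all seen =
    suc (length seen + length all +
      (if ⌊ f (hd root) ∈? seen ⌋
       then walkCost cs (f ∘ tl) all seen
       else ((if isOdd (count (f (hd root)) all)
              then (if isLeafTree c then 0 else cost c (f ∘ hd))
              else 0)
             + walkCost cs (f ∘ tl) all (f (hd root) ∷ seen))))

-- The automorphisms of a rooted tree permute the children of the root, and two children lie
-- in one orbit (equivalently, have the same j-number) iff an automorphism maps one subtree onto
-- the other.  If every class of odd size has a child whose subtree has a nice automorphism, one
-- builds a nice automorphism of the whole tree: the children of a class are swapped in pairs
-- along isomorphisms, which moves all their leaves, and the child left over in an odd class
-- (whose subtree, being isomorphic to the chosen one, also has a nice automorphism) is mapped
-- to itself.  Conversely a nice automorphism σ induces an involution on the children; it must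
-- fix a child in each class of odd size, and σ restricts to a nice automorphism of that child's
-- subtree.  This recursive characterisation is exactly what the procedure checks.
-- For the running time, a call at a vertex with d children and subtrees of sizes s₁, …, s_d
-- costs O(d²) plus the recursive calls, and (1 + d)² + 4 Σ sᵢ² ≤ (1 + 2 Σ sᵢ)² yields 8 N².

module Submission where

open import Defs
open import Data.Nat using (ℕ; zero; suc; _+_; _*_; _≤_; z≤n; s≤s; _^_)
import Data.Nat.Properties as ℕ
open import Data.Nat.DivMod using (_%_; [m+n]%n≡m%n)
open import Data.Nat.Tactic.RingSolver using (solve-∀)
open import Data.Fin using (Fin; zero; suc; toℕ)
import Data.Fin.Properties as Fin
open import Data.Fin.Permutation using (permutation)
open import Algebra.Properties.CommutativeMonoid.Sum ℕ.+-0-commutativeMonoid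
  using (sum; sum-permute; ∑-distrib-+; sum-cong-≗)
open import Data.Integer using (ℤ)
import Data.Integer as ℤ
open import Data.Bool using (Bool; true; false; if_then_else_)
open import Data.List using (List; []; _∷_; length; lookup; filter; _++_; [_]; map)
import Data.List.Properties as List
open import Data.List.Membership.Propositional using (_∈_; find)
open import Data.List.Membership.Propositional.Properties using (∈-∃++; ∈-++⁺ˡ; ∈-++⁺ʳ; ∈-++⁻)
open import Data.List.Membership.DecPropositional ℤ._≟_ using (_∈?_)
open import Data.List.Relation.Unary.Any using (here; there; any?)
open import Data.List.Relation.Unary.All using (All; []; _∷_)
import Data.List.Relation.Unary.All as All
open import Data.List.Relation.Unary.All.Properties using (¬Any⇒All¬) renaming (map⁺ to All-map⁺)
open import Data.List.Relation.Binary.Permutation.Propositional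
  using (_↭_; prep; ↭-sym) renaming (refl to ↭-refl; swap to ↭-swap; trans to ↭-trans)
open import Data.List.Relation.Binary.Permutation.Propositional.Properties using (shift; map⁺)
open import Data.Maybe using (Maybe; just; nothing; maybe′)
import Data.Maybe as Maybe
import Data.Maybe.Properties as Maybe
open import Data.Product using (Σ; _×_; _,_; proj₁; proj₂; ∃-syntax)
open import Data.Sum using (_⊎_; inj₁; inj₂)
import Data.Sum
open import Data.Empty using (⊥-elim)
open import Relation.Nullary using (¬_; Dec; yes; no; contradiction)
open import Relation.Nullary.Decidable using (⌊_⌋; _×-dec_)
open import Relation.Binary.PropositionalEquality hiding ([_])
open import Function using (_∘_; id)
open import Function.Bundles using (_⇔_; mk⇔; Equivalence)

map≡just : ∀ {A B : Set} {f : A → B} (m : Maybe A) {y} → Maybe.map f m ≡ just y → ∃[ x ] m ≡ just x × f x ≡ y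
map≡just (just x) refl = x , refl , refl

-- Counting and parity

indicator : ℤ → ℤ → ℕ
indicator x v with x ℤ.≟ v
... | yes _ = 1
... | no _  = 0

-- The fibre splits into pairs {a, π a}; `lower` counts each pair at its smaller element, `upper` at its larger one.
involution-fibre-even : ∀ {n} (g : Fin n → ℤ) (π : Fin n → Fin n) →
  (∀ a → π (π a) ≡ a) → (∀ a → g (π a) ≡ g a) →
  ∀ v → (∀ a → g a ≡ v → π a ≢ a) →
  ∃[ h ] sum (λ a → indicator (g a) v) ≡ h + h
involution-fibre-even g π π-invol g∘π v no-fixed = sum lower , (begin
    sum (λ a → indicator (g a) v)  ≡⟨ sum-cong-≗ split ⟩
    sum (λ a → lower a + upper a)  ≡⟨ ∑-distrib-+ lower upper ⟩
    sum lower + sum upper          ≡⟨ cong (sum lower +_) (sum-permute upper (permutation π π π-invol π-invol)) ⟩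
    sum lower + sum (upper ∘ π)    ≡⟨ cong (sum lower +_) (sum-cong-≗ upper∘π) ⟩
    sum lower + sum lower          ∎)
  where
  open ≡-Reasoning
  precedes : ∀ {n} → Fin n → Fin n → ℕ
  precedes a b with toℕ a ℕ.<? toℕ b
  ... | yes _ = 1
  ... | no _  = 0
  lower upper : Fin _ → ℕ
  lower a = indicator (g a) v * precedes a (π a)
  upper a = indicator (g a) v * precedes (π a) a
  split : ∀ a → indicator (g a) v ≡ lower a + upper a
  split a with g a ℤ.≟ v
  ... | no _ = refl
  ... | yes ga≡v with toℕ a ℕ.<? toℕ (π a) | toℕ (π a) ℕ.<? toℕ a
  ...   | yes a<πa | yes πa<a = ⊥-elim (ℕ.<-asym a<πa πa<a)
  ...   | yes _    | no _     = refl
  ...   | no _     | yes _    = refl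
  ...   | no a≮πa  | no πa≮a  =
          ⊥-elim (no-fixed a ga≡v (Fin.toℕ-injective (ℕ.≤-antisym (ℕ.≮⇒≥ a≮πa) (ℕ.≮⇒≥ πa≮a))))
  upper∘π : ∀ a → upper (π a) ≡ lower a
  upper∘π a = cong₂ _*_ (cong (λ x → indicator x v) (g∘π a)) (cong (λ x → precedes x (π a)) (π-invol a))

module _ {L : Set} where

  private variable
    l     : L
    t u   : Tree L
    ts us : List (Tree L)

  -- `count` and `isOdd` carry the label type as an unused implicit argument.
  private
    occ : ℤ → List ℤ → ℕ
    occ = count {L}
    odd : ℕ → Bool
    odd = isOdd {L}

  count-++ : ∀ v (xs ys : List ℤ) → occ v (xs ++ ys) ≡ occ v xs + occ v ys
  count-++ v xs ys = trans (cong length (List.filter-++ (ℤ._≟ v) xs ys)) (List.length-++ (filter (ℤ._≟ v) xs))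

  count-≡ : ∀ {v x} (xs : List ℤ) → x ≡ v → occ v (x ∷ xs) ≡ suc (occ v xs)
  count-≡ {v} xs x≡v = cong length (List.filter-accept (ℤ._≟ v) x≡v)

  count-≢ : ∀ {v x} (xs : List ℤ) → x ≢ v → occ v (x ∷ xs) ≡ occ v xs
  count-≢ {v} xs x≢v = cong length (List.filter-reject (ℤ._≟ v) x≢v)

  count-absent : ∀ {v} {xs : List ℤ} → All (_≢ v) xs → occ v xs ≡ 0
  count-absent []               = refl
  count-absent {xs = _ ∷ xs} (x≢v ∷ xs≢v) = trans (count-≢ xs x≢v) (count-absent xs≢v)

  isOdd-2+ : ∀ n → odd (2 + n) ≡ odd n
  isOdd-2+ n = cong (λ m → ⌊ m Data.Nat.≟ 1 ⌋) (trans (cong (_% 2) (ℕ.+-comm 2 n)) ([m+n]%n≡m%n n 2))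

  isOdd-double : ∀ n → odd (n + n) ≡ false
  isOdd-double zero    = refl
  isOdd-double (suc n) = trans (cong (odd ∘ suc) (ℕ.+-suc n n)) (trans (isOdd-2+ (n + n)) (isOdd-double n))

  isOdd-count-drop-pair : ∀ v {a b} (xs ys : List ℤ) → a ≡ b →
    odd (occ v (a ∷ xs ++ b ∷ ys)) ≡ odd (occ v (xs ++ ys))
  isOdd-count-drop-pair v {a} xs ys refl = drop (a ℤ.≟ v)
    where
    open ≡-Reasoning
    drop : Dec (a ≡ v) → odd (occ v (a ∷ xs ++ a ∷ ys)) ≡ odd (occ v (xs ++ ys))
    drop (yes a≡v) = begin
      odd (occ v (a ∷ xs ++ a ∷ ys))           ≡⟨ cong odd (count-≡ (xs ++ a ∷ ys) a≡v) ⟩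
      odd (suc (occ v (xs ++ a ∷ ys)))         ≡⟨ cong (odd ∘ suc) (count-++ v xs (a ∷ ys)) ⟩
      odd (suc (occ v xs + occ v (a ∷ ys)))    ≡⟨ cong (λ n → odd (suc (occ v xs + n))) (count-≡ ys a≡v) ⟩
      odd (suc (occ v xs + suc (occ v ys)))    ≡⟨ cong (odd ∘ suc) (ℕ.+-suc (occ v xs) (occ v ys)) ⟩
      odd (2 + (occ v xs + occ v ys))          ≡⟨ isOdd-2+ (occ v xs + occ v ys) ⟩
      odd (occ v xs + occ v ys)                ≡⟨ cong odd (count-++ v xs ys) ⟨
      odd (occ v (xs ++ ys))                   ∎
    drop (no a≢v) = cong odd (begin
      occ v (a ∷ xs ++ a ∷ ys)     ≡⟨ count-≢ (xs ++ a ∷ ys) a≢v ⟩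
      occ v (xs ++ a ∷ ys)         ≡⟨ count-++ v xs (a ∷ ys) ⟩
      occ v xs + occ v (a ∷ ys)    ≡⟨ cong (occ v xs +_) (count-≢ ys a≢v) ⟩
      occ v xs + occ v ys          ≡⟨ count-++ v xs ys ⟨
      occ v (xs ++ ys)             ∎)

  -- Forests and their isomorphisms

  -- Trees and child lists are both handled as vertex sets with a partial parent map
  -- (undefined exactly at the roots) and labels; isomorphisms commute with both.
  record Forest : Set₁ where
    field
      Vertex   : Set
      parentOf : Vertex → Maybe Vertex
      labelOf  : Vertex → L
  open Forest public

  ⟦_⟧ : Tree L → Forest
  ⟦ t ⟧ = record { Vertex = Pos t ; parentOf = parent ; labelOf = label }

  ⟦_⟧* : List (Tree L) → Forest
  ⟦ ts ⟧* = record { Vertex = PosL ts ; parentOf = parentL ; labelOf = labelL }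

  record _≅_ (A B : Forest) : Set where
    field
      to        : Vertex A → Vertex B
      from      : Vertex B → Vertex A
      from∘to   : ∀ p → from (to p) ≡ p
      to∘from   : ∀ q → to (from q) ≡ q
      to-parent : ∀ p → parentOf B (to p) ≡ Maybe.map to (parentOf A p)
      to-label  : ∀ p → labelOf B (to p) ≡ labelOf A p
  open _≅_ public

  ≅-refl : ∀ {A} → A ≅ A
  ≅-refl {A} = record
    { to = id ; from = id ; from∘to = λ _ → refl ; to∘from = λ _ → refl
    ; to-parent = λ p → sym (Maybe.map-id (parentOf A p)) ; to-label = λ _ → refl }

  ≅-sym : ∀ {A B} → A ≅ B → B ≅ A
  ≅-sym {A} {B} φ = record
    { to = from φ ; from = to φ ; from∘to = to∘from φ ; to∘from = from∘to φ
    ; to-parent = from-parent ; to-label = λ q → trans (sym (to-label φ (from φ q))) (cong (labelOf B) (to∘from φ q)) }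
    where
    from-parent : ∀ q → parentOf A (from φ q) ≡ Maybe.map (from φ) (parentOf B q)
    from-parent q = begin
      parentOf A (from φ q)                               ≡⟨ sym (trans (Maybe.map-cong (from∘to φ) (parentOf A (from φ q))) (Maybe.map-id (parentOf A (from φ q)))) ⟩
      Maybe.map (from φ ∘ to φ) (parentOf A (from φ q))   ≡⟨ Maybe.map-∘ (parentOf A (from φ q)) ⟩
      Maybe.map (from φ) (Maybe.map (to φ) (parentOf A (from φ q))) ≡⟨ cong (Maybe.map (from φ)) (sym (to-parent φ (from φ q))) ⟩
      Maybe.map (from φ) (parentOf B (to φ (from φ q)))   ≡⟨ cong (Maybe.map (from φ) ∘ parentOf B) (to∘from φ q) ⟩
      Maybe.map (from φ) (parentOf B q)                   ∎
      where open ≡-Reasoning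

  ≅-trans : ∀ {A B C} → A ≅ B → B ≅ C → A ≅ C
  ≅-trans {A} φ ψ = record
    { to = to ψ ∘ to φ ; from = from φ ∘ from ψ
    ; from∘to = λ p → trans (cong (from φ) (from∘to ψ (to φ p))) (from∘to φ p)
    ; to∘from = λ q → trans (cong (to ψ) (to∘from φ (from ψ q))) (to∘from ψ q)
    ; to-parent = λ p → trans (to-parent ψ (to φ p))
        (trans (cong (Maybe.map (to ψ)) (to-parent φ p)) (sym (Maybe.map-∘ (parentOf A p))))
    ; to-label = λ p → trans (to-label ψ (to φ p)) (to-label φ p) }

  to-parent-just : ∀ {A B} (φ : A ≅ B) {p q} → parentOf A p ≡ just q → parentOf B (to φ p) ≡ just (to φ q)
  to-parent-just φ {p} p→q = trans (to-parent φ p) (cong (Maybe.map (to φ)) p→q)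

  IsLeafOf : (A : Forest) → Vertex A → Set
  IsLeafOf A p = ∀ q → parentOf A q ≢ just p

  IsNice : (A : Forest) → A ≅ A → Set
  IsNice A σ = ∀ p → IsLeafOf A p → to σ (to σ p) ≡ p × to σ p ≢ p

  NiceAut : Forest → Set
  NiceAut A = Σ (A ≅ A) (IsNice A)

  to-leaf : ∀ {A B} (φ : A ≅ B) {p} → IsLeafOf A p → IsLeafOf B (to φ p)
  to-leaf {A} {B} φ {p} p-leaf q parent≡p = p-leaf (from φ q) (begin
      parentOf A (from φ q)            ≡⟨ to-parent (≅-sym φ) q ⟩
      Maybe.map (from φ) (parentOf B q) ≡⟨ cong (Maybe.map (from φ)) parent≡p ⟩
      just (from φ (to φ p))           ≡⟨ cong just (from∘to φ p) ⟩
      just p                           ∎)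
    where open ≡-Reasoning

  NiceAut-transport : ∀ {A B} → A ≅ B → NiceAut A → NiceAut B
  NiceAut-transport φ (σ , σ-nice) = ≅-trans (≅-sym φ) (≅-trans σ φ) , λ q q-leaf →
    let (σσ≡id , σ≢id) = σ-nice (from φ q) (to-leaf (≅-sym φ) q-leaf)
    in trans (cong (to φ ∘ to σ) (from∘to φ _)) (trans (cong (to φ) σσ≡id) (to∘from φ q))
     , λ e → σ≢id (trans (sym (from∘to φ _)) (cong (from φ) e))

  parent≡nothing : (p : Pos t) → parent p ≡ nothing → p ≡ root
  parent≡nothing root _ = refl

  ≅-root : (φ : ⟦ t ⟧ ≅ ⟦ u ⟧) → to φ root ≡ root
  ≅-root φ = parent≡nothing (to φ root) (to-parent φ root)

  depth≡0 : (p : Pos t) → depth p ≡ 0 → p ≡ root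
  depth≡0 root _ = refl

  depth≡suc : (p : Pos t) {n : ℕ} → depth p ≡ suc n → ∃[ q ] parent p ≡ just q
  depth≡suc (sub q) _ = _ , refl

  parent-depth  : (p q : Pos t) → parent p ≡ just q → depth p ≡ suc (depth q)
  parentL-roots : (q : PosL ts) → parentL q ≡ nothing → depthL q ≡ 0
  parentL-depth : (q r : PosL ts) → parentL q ≡ just r → depthL q ≡ suc (depthL r)

  parent-depth (sub q) _ e with parentL q in eq
  parent-depth (sub q) _ refl | nothing = cong suc (parentL-roots q eq)
  parent-depth (sub q) _ refl | just r  = cong suc (parentL-depth q r eq)

  parentL-roots (hd p) e with parent p in eq
  ... | nothing = cong depth (parent≡nothing p eq)
  parentL-roots (tl q) e with parentL q in eq
  ... | nothing = parentL-roots q eq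

  parentL-depth (hd p) _ e with parent p in eq
  parentL-depth (hd p) _ refl | just p′ = parent-depth p p′ eq
  parentL-depth (tl q) _ e with parentL q in eq
  parentL-depth (tl q) _ refl | just q′ = parentL-depth q q′ eq

  parent-asymmetric : {p q : Pos t} → parent p ≡ just q → parent q ≢ just p
  parent-asymmetric {p = p} {q} p→q q→p = ℕ.m≢1+n+m (depth p) {1} (begin
      depth p             ≡⟨ parent-depth p q p→q ⟩
      suc (depth q)       ≡⟨ cong suc (parent-depth q p q→p) ⟩
      suc (suc (depth p)) ∎)
    where open ≡-Reasoning

  module _ (σ : Automorphism t) where
    private
      adjacent : ∀ {p q} → Adj p q → Adj (fun σ p) (fun σ q)
      adjacent = Equivalence.to (adj-pres σ _ _)

      fun-injective : ∀ {p q} → fun σ p ≡ fun σ q → p ≡ q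
      fun-injective {p} {q} e = trans (sym (inv-fun σ p)) (trans (cong (inv σ) e) (inv-fun σ q))

    -- The image of the parent q of p is adjacent to fun σ p; it cannot be a child of fun σ p,
    -- because fun σ already commutes with parent at q, which is one level higher.
    fun-parent-at-depth : ∀ n (p : Pos t) → depth p ≡ n → parent (fun σ p) ≡ Maybe.map (fun σ) (parent p)
    fun-parent-at-depth zero p d rewrite depth≡0 p d = cong parent (root-fixed σ)
    fun-parent-at-depth (suc n) p d with depth≡suc p d
    ... | q , p→q with adjacent (inj₁ p→q)
    ...   | inj₁ σp→σq = trans σp→σq (sym (cong (Maybe.map (fun σ)) p→q))
    ...   | inj₂ σq→σp = ⊥-elim (parent-asymmetric p→q q→p)
      where
      q→p : parent q ≡ just p
      q→p with map≡just (parent q) (trans (sym (fun-parent-at-depth n q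
                 (ℕ.suc-injective (trans (sym (parent-depth p q p→q)) d)))) σq→σp)
      ... | x , q→x , σx≡σp = trans q→x (cong just (fun-injective σx≡σp))

  automorphism⇒≅ : Automorphism t → ⟦ t ⟧ ≅ ⟦ t ⟧
  automorphism⇒≅ σ = record
    { to = fun σ ; from = inv σ ; from∘to = inv-fun σ ; to∘from = fun-inv σ
    ; to-parent = λ p → fun-parent-at-depth σ (depth p) p refl ; to-label = label-pres σ }

  ≅⇒automorphism : ⟦ t ⟧ ≅ ⟦ t ⟧ → Automorphism t
  ≅⇒automorphism φ = record
    { fun = to φ ; inv = from φ ; inv-fun = from∘to φ ; fun-inv = to∘from φ
    ; adj-pres = λ p q → mk⇔ (Data.Sum.map (to-parent-just φ) (to-parent-just φ))
                             (Data.Sum.map (reflect p q) (reflect q p))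
    ; root-fixed = ≅-root φ ; label-pres = to-label φ }
    where
    reflect : ∀ p q → parent (to φ p) ≡ just (to φ q) → parent p ≡ just q
    reflect p q e = subst₂ (λ x y → parent x ≡ just y) (from∘to φ p) (from∘to φ q) (to-parent-just (≅-sym φ) e)

  within : ∀ {ts : List (Tree L)} (i : Fin (length ts)) → Pos (lookup ts i) → PosL ts
  within {_ ∷ _} zero    p = hd p
  within {_ ∷ _} (suc i) p = tl (within i p)

  below : ∀ {l} {ts : List (Tree L)} (i : Fin (length ts)) → Pos (lookup ts i) → Pos (node l ts)
  below i p = sub (within i p)

  private
    hd-injective : ∀ {a b : Pos t} → hd {ts = ts} a ≡ hd b → a ≡ b
    hd-injective refl = refl

    tl-injective : ∀ {a b : PosL ts} → tl {t = t} a ≡ tl b → a ≡ b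
    tl-injective refl = refl

    sub-injective : ∀ {a b : PosL ts} → sub {l = l} a ≡ sub b → a ≡ b
    sub-injective refl = refl

  within-injective : (i : Fin (length ts)) {p q : Pos (lookup ts i)} → within {ts} i p ≡ within i q → p ≡ q
  within-injective {_ ∷ _} zero    e    = hd-injective e
  within-injective {_ ∷ _} (suc i) e    = within-injective i (tl-injective e)

  within-index : (i k : Fin (length ts)) {p : Pos (lookup ts i)} {q : Pos (lookup ts k)} →
                 within {ts} i p ≡ within k q → i ≡ k
  within-index {_ ∷ _} zero    zero    _ = refl
  within-index {_ ∷ _} zero    (suc k) ()
  within-index {_ ∷ _} (suc i) zero    ()
  within-index {_ ∷ _} (suc i) (suc k) e = cong suc (within-index i k (tl-injective e))

  below-injective : (i : Fin (length ts)) {p q : Pos (lookup ts i)} → below {l} {ts} i p ≡ below i q → p ≡ q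
  below-injective i e = within-injective i (sub-injective e)

  below-index : (i k : Fin (length ts)) {p : Pos (lookup ts i)} {q : Pos (lookup ts k)} →
                below {l} {ts} i p ≡ below k q → i ≡ k
  below-index i k e = within-index i k (sub-injective e)

  parentL-within : (i : Fin (length ts)) (p : Pos (lookup ts i)) →
                   parentL (within {ts} i p) ≡ Maybe.map (within i) (parent p)
  parentL-within {_ ∷ _} zero    p = refl
  parentL-within {_ ∷ _} (suc i) p =
    trans (cong (Maybe.map tl) (parentL-within i p)) (sym (Maybe.map-∘ (parent p)))

  parent-below : (i : Fin (length ts)) (p : Pos (lookup ts i)) →
                 parent (below {l} {ts} i p) ≡ just (maybe′ (below i) root (parent p))
  parent-below i p = cong just (trans (cong (maybe′ sub root) (parentL-within i p)) (lemma (parent p)))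
    where
    lemma : ∀ m → maybe′ sub root (Maybe.map (within i) m) ≡ maybe′ (below i) root m
    lemma nothing  = refl
    lemma (just _) = refl

  labelL-within : (i : Fin (length ts)) (p : Pos (lookup ts i)) → labelL (within {ts} i p) ≡ label p
  labelL-within {_ ∷ _} zero    p = refl
  labelL-within {_ ∷ ts} (suc i) p = labelL-within {ts} i p

  depthL-within : (i : Fin (length ts)) (p : Pos (lookup ts i)) → depthL (within {ts} i p) ≡ depth p
  depthL-within {_ ∷ _} zero    p = refl
  depthL-within {_ ∷ ts} (suc i) p = depthL-within {ts} i p

  parentL≡nothing : (q : PosL ts) → parentL q ≡ nothing → ∃[ i ] q ≡ within i root
  parentL≡nothing (hd p) e with parent p in eq
  ... | nothing = zero , cong hd (parent≡nothing p eq)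
  parentL≡nothing (tl q) e with parentL q in eq
  ... | nothing = let (i , q≡) = parentL≡nothing q eq in suc i , cong tl q≡

  parentL≡within : (k : Fin (length ts)) {r : Pos (lookup ts k)} (q : PosL ts) →
    parentL q ≡ just (within k r) → ∃[ r′ ] q ≡ within k r′ × parent r′ ≡ just r
  parentL≡within {_ ∷ _} zero    (hd p) e with map≡just (parent p) e
  ... | _ , p→ , refl = p , refl , p→
  parentL≡within {_ ∷ _} zero    (tl q) e with map≡just (parentL q) e
  ... | _ , _ , ()
  parentL≡within {_ ∷ _} (suc k) (hd p) e with map≡just (parent p) e
  ... | _ , _ , ()
  parentL≡within {_ ∷ ts} (suc k) (tl q) e with map≡just (parentL q) e
  ... | _ , q→ , refl = let (r′ , q≡ , r′→) = parentL≡within {ts} k q q→ in r′ , cong tl q≡ , r′→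

  parent≡root : (x : Pos (node l ts)) → parent x ≡ just root → ∃[ k ] x ≡ below k root
  parent≡root (sub q) e with parentL q in eq
  parent≡root (sub q) refl | nothing = let (k , q≡) = parentL≡nothing q eq in k , cong sub q≡

  parent≡below : (k : Fin (length ts)) {r : Pos (lookup ts k)} (x : Pos (node l ts)) →
    parent x ≡ just (below k r) → ∃[ r′ ] x ≡ below k r′ × parent r′ ≡ just r
  parent≡below k (sub q) e with parentL q in eq
  parent≡below k (sub q) refl | just _ = let (r′ , q≡ , r′→) = parentL≡within k q eq in r′ , cong sub q≡ , r′→

  below-leaf : (k : Fin (length ts)) {r : Pos (lookup ts k)} → IsLeaf r → IsLeaf (below {l} {ts} k r)
  below-leaf k r-leaf x x→ = let (r′ , _ , r′→) = parent≡below k x x→ in r-leaf r′ r′→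

  maybe-below-injective : (k : Fin (length ts)) (m m′ : Maybe (Pos (lookup ts k))) →
    maybe′ (below {l} {ts} k) root m ≡ maybe′ (below k) root m′ → m ≡ m′
  maybe-below-injective k nothing  nothing  _ = refl
  maybe-below-injective k nothing  (just _) ()
  maybe-below-injective k (just _) nothing  ()
  maybe-below-injective k (just _) (just _) e = cong just (below-injective k e)

  module _ {l l′} {ts us : List (Tree L)} (φ : ⟦ node l ts ⟧ ≅ ⟦ node l′ us ⟧)
           (i : Fin (length ts)) (k : Fin (length us)) (i↦k : to φ (below i root) ≡ below k root) where

    private
      -- Induction on depth: p is a child of its parent, whose image already lies in subtree k.
      into-subtree : ∀ n (p : Pos (lookup ts i)) → depth p ≡ n → ∃[ r ] to φ (below i p) ≡ below k r
      into-subtree zero p d rewrite depth≡0 p d = root , i↦k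
      into-subtree (suc n) p d with depth≡suc p d
      ... | p′ , p→p′ =
        let (r′ , φp′≡) = into-subtree n p′ (ℕ.suc-injective (trans (sym (parent-depth p p′ p→p′)) d))
            φp→ = to-parent-just φ (trans (parent-below i p) (cong (just ∘ maybe′ (below i) root) p→p′))
            (r , φp≡ , _) = parent≡below k (to φ (below i p)) (trans φp→ (cong just φp′≡))
        in r , φp≡

    restrict-to : Pos (lookup ts i) → Pos (lookup us k)
    restrict-to p = proj₁ (into-subtree (depth p) p refl)

    to-below : ∀ p → to φ (below i p) ≡ below k (restrict-to p)
    to-below p = proj₂ (into-subtree (depth p) p refl)

  restrict : ∀ {l l′} {ts us : List (Tree L)} (φ : ⟦ node l ts ⟧ ≅ ⟦ node l′ us ⟧) i k →
    to φ (below i root) ≡ below k root →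
    Σ (⟦ lookup ts i ⟧ ≅ ⟦ lookup us k ⟧) λ ψ → ∀ p → to φ (below i p) ≡ below k (to ψ p)
  restrict {l} {l′} {ts} {us} φ i k i↦k = ψ , F-spec
    where
    k↦i : from φ (below k root) ≡ below i root
    k↦i = trans (cong (from φ) (sym i↦k)) (from∘to φ _)
    F : Pos (lookup ts i) → Pos (lookup us k)
    F = restrict-to φ i k i↦k
    G : Pos (lookup us k) → Pos (lookup ts i)
    G = restrict-to (≅-sym φ) k i k↦i
    F-spec : ∀ p → to φ (below i p) ≡ below k (F p)
    F-spec = to-below φ i k i↦k
    G-spec : ∀ q → from φ (below k q) ≡ below i (G q)
    G-spec = to-below (≅-sym φ) k i k↦i

    to-maybe-below : ∀ m → to φ (maybe′ (below i) root m) ≡ maybe′ (below k) root (Maybe.map F m)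
    to-maybe-below nothing  = ≅-root φ
    to-maybe-below (just p) = F-spec p

    F-parent : ∀ p → parent (F p) ≡ Maybe.map F (parent p)
    F-parent p = maybe-below-injective k _ _ (Maybe.just-injective (begin
      just (maybe′ (below k) root (parent (F p)))         ≡⟨ sym (parent-below k (F p)) ⟩
      parent (below k (F p))                              ≡⟨ cong parent (sym (F-spec p)) ⟩
      parent (to φ (below i p))                           ≡⟨ to-parent φ (below i p) ⟩
      Maybe.map (to φ) (parent (below i p))               ≡⟨ cong (Maybe.map (to φ)) (parent-below i p) ⟩
      just (to φ (maybe′ (below i) root (parent p)))      ≡⟨ cong just (to-maybe-below (parent p)) ⟩
      just (maybe′ (below k) root (Maybe.map F (parent p))) ∎))
      where open ≡-Reasoning

    ψ : ⟦ lookup ts i ⟧ ≅ ⟦ lookup us k ⟧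
    ψ = record
      { to = F ; from = G
      ; from∘to = λ p → below-injective i (begin
          below i (G (F p))           ≡⟨ sym (G-spec (F p)) ⟩
          from φ (below k (F p))      ≡⟨ cong (from φ) (sym (F-spec p)) ⟩
          from φ (to φ (below i p))   ≡⟨ from∘to φ _ ⟩
          below i p                   ∎)
      ; to∘from = λ q → below-injective k (begin
          below k (F (G q))           ≡⟨ sym (F-spec (G q)) ⟩
          to φ (below i (G q))        ≡⟨ cong (to φ) (sym (G-spec q)) ⟩
          to φ (from φ (below k q))   ≡⟨ to∘from φ _ ⟩
          below k q                   ∎)
      ; to-parent = F-parent
      ; to-label = λ p → begin
          label (F p)                      ≡⟨ sym (labelL-within {us} k (F p)) ⟩
          label (below {l′} {us} k (F p))  ≡⟨ cong label (sym (F-spec p)) ⟩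
          label (to φ (below i p))         ≡⟨ to-label φ (below i p) ⟩
          label (below {l} {ts} i p)       ≡⟨ labelL-within {ts} i p ⟩
          label p                          ∎ }
      where open ≡-Reasoning

  -- Building nice automorphisms

  ∷-≅ : ⟦ t ⟧ ≅ ⟦ u ⟧ → ⟦ ts ⟧* ≅ ⟦ us ⟧* → ⟦ t ∷ ts ⟧* ≅ ⟦ u ∷ us ⟧*
  ∷-≅ {t} {u} {ts} {us} φ ψ = record
    { to = F ; from = G ; from∘to = G∘F ; to∘from = F∘G ; to-parent = F-parent ; to-label = F-label }
    where
    F : PosL (t ∷ ts) → PosL (u ∷ us)
    F (hd p) = hd (to φ p)
    F (tl q) = tl (to ψ q)
    G : PosL (u ∷ us) → PosL (t ∷ ts)
    G (hd p) = hd (from φ p)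
    G (tl q) = tl (from ψ q)
    G∘F : ∀ p → G (F p) ≡ p
    G∘F (hd p) = cong hd (from∘to φ p)
    G∘F (tl q) = cong tl (from∘to ψ q)
    F∘G : ∀ p → F (G p) ≡ p
    F∘G (hd p) = cong hd (to∘from φ p)
    F∘G (tl q) = cong tl (to∘from ψ q)
    F-parent : ∀ p → parentL (F p) ≡ Maybe.map F (parentL p)
    F-parent (hd p) = trans (cong (Maybe.map hd) (to-parent φ p)) (trans (sym (Maybe.map-∘ (parent p))) (Maybe.map-∘ (parent p)))
    F-parent (tl q) = trans (cong (Maybe.map tl) (to-parent ψ q)) (trans (sym (Maybe.map-∘ (parentL q))) (Maybe.map-∘ (parentL q)))
    F-label : ∀ p → labelL (F p) ≡ labelL p
    F-label (hd p) = to-label φ p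
    F-label (tl q) = to-label ψ q

  swap-≅ : ⟦ t ∷ u ∷ ts ⟧* ≅ ⟦ u ∷ t ∷ ts ⟧*
  swap-≅ = record
    { to = swap ; from = swap ; from∘to = swap-swap ; to∘from = swap-swap ; to-parent = swap-parent ; to-label = swap-label }
    where
    swap : ∀ {a b : Tree L} {cs} → PosL (a ∷ b ∷ cs) → PosL (b ∷ a ∷ cs)
    swap (hd p)      = tl (hd p)
    swap (tl (hd p)) = hd p
    swap (tl (tl r)) = tl (tl r)
    swap-swap : ∀ {a b : Tree L} {cs} (p : PosL (a ∷ b ∷ cs)) → swap (swap p) ≡ p
    swap-swap (hd p)      = refl
    swap-swap (tl (hd p)) = refl
    swap-swap (tl (tl r)) = refl
    swap-parent : ∀ {a b : Tree L} {cs} (p : PosL (a ∷ b ∷ cs)) → parentL (swap p) ≡ Maybe.map swap (parentL p)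
    swap-parent (hd p) with parent p
    ... | nothing = refl
    ... | just _  = refl
    swap-parent (tl (hd p)) with parent p
    ... | nothing = refl
    ... | just _  = refl
    swap-parent (tl (tl r)) with parentL r
    ... | nothing = refl
    ... | just _  = refl
    swap-label : ∀ {a b : Tree L} {cs} (p : PosL (a ∷ b ∷ cs)) → labelL (swap p) ≡ labelL p
    swap-label (hd p)      = refl
    swap-label (tl (hd p)) = refl
    swap-label (tl (tl r)) = refl

  node-≅ : ⟦ ts ⟧* ≅ ⟦ us ⟧* → ⟦ node l ts ⟧ ≅ ⟦ node l us ⟧
  node-≅ {ts} {us} {l} ψ = record
    { to = F ; from = G ; from∘to = G∘F ; to∘from = F∘G ; to-parent = F-parent ; to-label = F-label }
    where
    F : Pos (node l ts) → Pos (node l us)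
    F root    = root
    F (sub q) = sub (to ψ q)
    G : Pos (node l us) → Pos (node l ts)
    G root    = root
    G (sub q) = sub (from ψ q)
    G∘F : ∀ p → G (F p) ≡ p
    G∘F root    = refl
    G∘F (sub q) = cong sub (from∘to ψ q)
    F∘G : ∀ p → F (G p) ≡ p
    F∘G root    = refl
    F∘G (sub q) = cong sub (to∘from ψ q)
    F-maybe : ∀ m → maybe′ sub root (Maybe.map (to ψ) m) ≡ F (maybe′ sub root m)
    F-maybe nothing  = refl
    F-maybe (just _) = refl
    F-parent : ∀ p → parent (F p) ≡ Maybe.map F (parent p)
    F-parent root    = refl
    F-parent (sub q) = cong just (trans (cong (maybe′ sub root) (to-parent ψ q)) (F-maybe (parentL q)))
    F-label : ∀ p → label (F p) ≡ label p
    F-label root    = refl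
    F-label (sub q) = to-label ψ q

  ↭⇒≅ : ts ↭ us → ⟦ ts ⟧* ≅ ⟦ us ⟧*
  ↭⇒≅ ↭-refl             = ≅-refl
  ↭⇒≅ (prep _ ts↭us)     = ∷-≅ ≅-refl (↭⇒≅ ts↭us)
  ↭⇒≅ (↭-swap _ _ ts↭us) = ≅-trans (∷-≅ ≅-refl (∷-≅ ≅-refl (↭⇒≅ ts↭us))) swap-≅
  ↭⇒≅ (↭-trans p q)      = ≅-trans (↭⇒≅ p) (↭⇒≅ q)

  private
    hd-leaf : {p : Pos t} → IsLeafOf ⟦ t ∷ ts ⟧* (hd p) → IsLeafOf ⟦ t ⟧ p
    hd-leaf leaf q e = leaf (hd q) (cong (Maybe.map hd) e)

    tl-leaf : {q : PosL ts} → IsLeafOf ⟦ t ∷ ts ⟧* (tl q) → IsLeafOf ⟦ ts ⟧* q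
    tl-leaf leaf r e = leaf (tl r) (cong (Maybe.map tl) e)

    sub-leaf : {q : PosL ts} → IsLeafOf ⟦ node l ts ⟧ (sub q) → IsLeafOf ⟦ ts ⟧* q
    sub-leaf leaf r e = leaf (sub r) (cong (just ∘ maybe′ sub root) e)

  NiceAut-[] : NiceAut ⟦ [] ⟧*
  NiceAut-[] = ≅-refl , λ ()

  NiceAut-∷ : NiceAut ⟦ t ⟧ → NiceAut ⟦ ts ⟧* → NiceAut ⟦ t ∷ ts ⟧*
  NiceAut-∷ (σ , σ-nice) (ν , ν-nice) = ∷-≅ σ ν , λ where
    (hd p) leaf → let (invol , moves) = σ-nice p (hd-leaf leaf) in cong hd invol , moves ∘ hd-injective
    (tl q) leaf → let (invol , moves) = ν-nice q (tl-leaf leaf) in cong tl invol , moves ∘ tl-injective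

  -- t and u are exchanged along φ, which moves every leaf of both.
  NiceAut-pair : ⟦ t ⟧ ≅ ⟦ u ⟧ → NiceAut ⟦ ts ⟧* → NiceAut ⟦ t ∷ u ∷ ts ⟧*
  NiceAut-pair φ (ν , ν-nice) = ≅-trans (∷-≅ φ (∷-≅ (≅-sym φ) ν)) swap-≅ , λ where
    (hd p)      _    → cong hd (from∘to φ p) , λ ()
    (tl (hd p)) _    → cong (tl ∘ hd) (to∘from φ p) , λ ()
    (tl (tl r)) leaf → let (invol , moves) = ν-nice r (tl-leaf (tl-leaf leaf))
                       in cong (tl ∘ tl) invol , moves ∘ tl-injective ∘ tl-injective

  NiceAut-node : NiceAut ⟦ t ∷ ts ⟧* → NiceAut ⟦ node l (t ∷ ts) ⟧
  NiceAut-node (ν , ν-nice) = node-≅ ν , λ where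
    root    leaf → ⊥-elim (leaf (sub (hd root)) refl)
    (sub q) leaf → let (invol , moves) = ν-nice q (sub-leaf leaf) in cong sub invol , moves ∘ sub-injective

  ¬NiceAut-leaf : ¬ NiceAut ⟦ node l [] ⟧
  ¬NiceAut-leaf (σ , σ-nice) = proj₂ (σ-nice root (λ { (sub ()) })) (≅-root σ)

  SameKeyIsomorphic : List (Tree L × ℤ) → Set
  SameKeyIsomorphic xs = ∀ {x y} → x ∈ xs → y ∈ xs → proj₂ x ≡ proj₂ y → ⟦ proj₁ x ⟧ ≅ ⟦ proj₁ y ⟧

  OddKeyNice : List (Tree L × ℤ) → Set
  OddKeyNice xs = ∀ {x} → x ∈ xs → odd (occ (proj₂ x) (map proj₂ xs)) ≡ true → NiceAut ⟦ proj₁ x ⟧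

  -- The head is swapped with a later tree of the same key if there is one;
  -- otherwise its key occurs once, so it carries a nice automorphism itself.
  pair-up : ∀ n (xs : List (Tree L × ℤ)) → length xs ≤ n →
    SameKeyIsomorphic xs → OddKeyNice xs → NiceAut ⟦ map proj₁ xs ⟧*
  pair-up _       []         _         _   _    = NiceAut-[]
  pair-up (suc n) (x ∷ rest) (s≤s len) iso nice with any? (λ y → proj₂ y ℤ.≟ proj₂ x) rest
  ... | no no-partner = NiceAut-∷ (nice (here refl) x-alone)
                          (pair-up n rest len (λ y z → iso (there y) (there z)) rest-nice)
    where
    others : All (λ y → proj₂ y ≢ proj₂ x) rest
    others = ¬Any⇒All¬ rest no-partner
    x-alone : odd (occ (proj₂ x) (map proj₂ (x ∷ rest))) ≡ true
    x-alone = cong odd (trans (count-≡ (map proj₂ rest) refl)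
                (cong suc (count-absent (All-map⁺ others))))
    rest-nice : OddKeyNice rest
    rest-nice {z} z∈rest odd-z = nice (there z∈rest)
      (trans (cong odd (count-≢ (map proj₂ rest) (λ x≡z → All.lookup others z∈rest (sym x≡z)))) odd-z)
  ... | yes has-partner with find has-partner
  ...   | y , y∈rest , y≡x with ∈-∃++ y∈rest
  ...     | as , bs , refl =
    NiceAut-transport (↭⇒≅ (map⁺ proj₁ (prep x (↭-sym (shift y as bs)))))
      (NiceAut-pair (iso (here refl) (there (∈-++⁺ʳ as (here refl))) (sym y≡x))
        (pair-up n (as ++ bs) (ℕ.≤-trans (shorter as) len) (λ a b → iso (keep a) (keep b)) rest-nice))
    where
    shorter : ∀ (cs : List (Tree L × ℤ)) → length (cs ++ bs) ≤ length (cs ++ [ y ] ++ bs)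
    shorter []       = ℕ.n≤1+n _
    shorter (_ ∷ cs) = s≤s (shorter cs)
    keep : ∀ {z} → z ∈ as ++ bs → z ∈ x ∷ as ++ [ y ] ++ bs
    keep z∈ with ∈-++⁻ as z∈
    ... | inj₁ z∈as = there (∈-++⁺ˡ z∈as)
    ... | inj₂ z∈bs = there (∈-++⁺ʳ as (there z∈bs))
    rest-nice : OddKeyNice (as ++ bs)
    rest-nice {z} z∈ odd-z = nice (keep z∈) (begin
      odd (occ (proj₂ z) (proj₂ x ∷ map proj₂ (as ++ [ y ] ++ bs)))     ≡⟨ cong (λ ks → odd (occ (proj₂ z) (proj₂ x ∷ ks))) (List.map-++ proj₂ as (y ∷ bs)) ⟩
      odd (occ (proj₂ z) (proj₂ x ∷ map proj₂ as ++ proj₂ y ∷ map proj₂ bs)) ≡⟨ isOdd-count-drop-pair (proj₂ z) (map proj₂ as) (map proj₂ bs) (sym y≡x) ⟩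
      odd (occ (proj₂ z) (map proj₂ as ++ map proj₂ bs))                 ≡⟨ cong (odd ∘ occ (proj₂ z)) (List.map-++ proj₂ as bs) ⟨
      odd (occ (proj₂ z) (map proj₂ (as ++ bs)))                          ≡⟨ odd-z ⟩
      true                                                               ∎)
      where open ≡-Reasoning

  child-image : ∀ {l l′} {ts us : List (Tree L)} (φ : ⟦ node l ts ⟧ ≅ ⟦ node l′ us ⟧) i →
    ∃[ k ] to φ (below i root) ≡ below k root
  child-image φ i = parent≡root (to φ (below i root))
    (trans (to-parent-just φ (parent-below i root)) (cong just (≅-root φ)))

  extend-at : (i : Fin (length ts)) → ⟦ lookup ts i ⟧ ≅ ⟦ lookup ts i ⟧ → ⟦ ts ⟧* ≅ ⟦ ts ⟧*
  extend-at {_ ∷ _} zero    ψ = ∷-≅ ψ ≅-refl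
  extend-at {_ ∷ _} (suc i) ψ = ∷-≅ ≅-refl (extend-at i ψ)

  to-extend-at : (i : Fin (length ts)) (ψ : ⟦ lookup ts i ⟧ ≅ ⟦ lookup ts i ⟧) (p : Pos (lookup ts i)) →
    to (extend-at i ψ) (within {ts} i p) ≡ within i (to ψ p)
  to-extend-at {_ ∷ _} zero    ψ p = refl
  to-extend-at {_ ∷ ts} (suc i) ψ p = cong tl (to-extend-at {ts = ts} i ψ p)

  some-leaf : (t : Tree L) → ∃[ p ] IsLeaf {t = t} p
  some-leaf (node l [])      = root , λ { (sub ()) }
  some-leaf (node l (c ∷ cs)) = let (p , p-leaf) = some-leaf c in below {l = l} {ts = c ∷ cs} zero p , below-leaf zero p-leaf

  depth-child : ∀ {l} {ts : List (Tree L)} (i : Fin (length ts)) → depth (below {l} {ts} i root) ≡ 1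
  depth-child {ts = ts} i = cong suc (depthL-within {ts} i root)

  NiceAut-restrict : (σ : ⟦ node l ts ⟧ ≅ ⟦ node l ts ⟧) → IsNice ⟦ node l ts ⟧ σ →
    ∀ w → to σ (below w root) ≡ below w root → NiceAut ⟦ lookup ts w ⟧
  NiceAut-restrict σ σ-nice w w↦w with restrict σ w w w↦w
  ... | ψ , σ-below = ψ , λ p p-leaf →
    let (invol , moves) = σ-nice (below w p) (below-leaf w p-leaf)
    in below-injective w (begin
         below w (to ψ (to ψ p))  ≡⟨ sym (σ-below (to ψ p)) ⟩
         to σ (below w (to ψ p))  ≡⟨ cong (to σ) (sym (σ-below p)) ⟩
         to σ (to σ (below w p))  ≡⟨ invol ⟩
         below w p                ∎)
     , λ ψp≡p → moves (trans (σ-below p) (cong (below w) ψp≡p))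
    where open ≡-Reasoning

  module _ {l} {ts : List (Tree L)} (j : Pos (node l ts) → ℤ) (jn : IsJNumbering (node l ts) j) where

    private
      same-depth : ∀ i k (p : Pos (lookup ts i)) (q : Pos (lookup ts k)) → depth p ≡ depth q →
                   depth (below {l = l} {ts = ts} i p) ≡ depth (below {l = l} {ts = ts} k q)
      same-depth i k p q d = cong suc (trans (depthL-within {ts} i p) (trans d (sym (depthL-within {ts} k q))))

    same-j⇒≅ : ∀ w i → j (below w root) ≡ j (below i root) → ⟦ lookup ts w ⟧ ≅ ⟦ lookup ts i ⟧
    same-j⇒≅ w i e =
      let (τ , τw≡i) = Equivalence.to (jn (below w root) (below i root) (same-depth w i root root refl)) e
      in proj₁ (restrict (automorphism⇒≅ τ) w i τw≡i)

    -- An automorphism relating two vertices of subtree i maps child i to some child k,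
    -- hence subtree i into subtree k; as it hits subtree i again, k = i, and it restricts.
    IsJNumbering-child : ∀ i → IsJNumbering (lookup ts i) (j ∘ below i)
    IsJNumbering-child i p q d = mk⇔ same-orbit same-j
      where
      jn-pq : (j (below i p) ≡ j (below i q)) ⇔ (Σ (Automorphism (node l ts)) λ τ → fun τ (below i p) ≡ below i q)
      jn-pq = jn (below i p) (below i q) (same-depth i i p q d)
      same-orbit : j (below i p) ≡ j (below i q) → Σ (Automorphism (lookup ts i)) λ σ → fun σ p ≡ q
      same-orbit e with Equivalence.to jn-pq e
      ... | τ , τp≡q with child-image (automorphism⇒≅ τ) i
      ...   | k , i↦k with restrict (automorphism⇒≅ τ) i k i↦k
      ...     | ψ , τ-below with below-index i k (trans (sym τp≡q) (τ-below p))
      ...       | refl = ≅⇒automorphism ψ , below-injective i (trans (sym (τ-below p)) τp≡q)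
      same-j : (Σ (Automorphism (lookup ts i)) λ σ → fun σ p ≡ q) → j (below i p) ≡ j (below i q)
      same-j (σ , σp≡q) = Equivalence.from jn-pq
        ( ≅⇒automorphism (node-≅ (extend-at i (automorphism⇒≅ σ)))
        , cong sub (trans (to-extend-at {ts} i (automorphism⇒≅ σ) p) (cong (within i) σp≡q)) )

  Checked : (cs : List (Tree L)) → (PosL cs → ℤ) → List ℤ → Fin (length cs) → Set
  Checked cs f all i = odd (occ (f (within i root)) all) ≡ true →
    isLeafTree (lookup cs i) ≡ false × hasNiceAutomorphism (lookup cs i) (f ∘ within i) ≡ true

  walk-complete : (cs : List (Tree L)) (f : PosL cs → ℤ) (all seen : List ℤ) →
    (∀ i → Checked cs f all i) → walk cs f all seen ≡ true
  walk-complete []       f all seen checked = refl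
  walk-complete (c ∷ cs) f all seen checked with ⌊ f (hd root) ∈? seen ⌋
  ... | true = walk-complete cs (f ∘ tl) all seen (checked ∘ suc)
  ... | false with odd (occ (f (hd root)) all) in odd-c
  ...   | false = walk-complete cs (f ∘ tl) all (f (hd root) ∷ seen) (checked ∘ suc)
  ...   | true rewrite proj₁ (checked zero odd-c) | proj₂ (checked zero odd-c) =
          walk-complete cs (f ∘ tl) all (f (hd root) ∷ seen) (checked ∘ suc)

  walk-new-class : ∀ c (cs : List (Tree L)) (f : PosL (c ∷ cs) → ℤ) (all seen : List ℤ) →
    ¬ f (hd root) ∈ seen → walk (c ∷ cs) f all seen ≡ true →
    Checked (c ∷ cs) f all zero × walk cs (f ∘ tl) all (f (hd root) ∷ seen) ≡ true
  walk-new-class c cs f all seen c∉seen w with f (hd root) ∈? seen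
  ... | yes c∈seen = ⊥-elim (c∉seen c∈seen)
  ... | no _ with odd (occ (f (hd root)) all)
  ...   | false = (λ ()) , w
  ...   | true with isLeafTree c | hasNiceAutomorphism c (f ∘ hd)
  ...     | false | true = (λ _ → refl , refl) , w

  Represented : (cs : List (Tree L)) → (PosL cs → ℤ) → List ℤ → List ℤ → Fin (length cs) → Set
  Represented cs f all seen i =
    f (within i root) ∈ seen ⊎ ∃[ k ] f (within k root) ≡ f (within i root) × Checked cs f all k

  walk-seen-class : ∀ c (cs : List (Tree L)) (f : PosL (c ∷ cs) → ℤ) (all seen : List ℤ) →
    f (hd root) ∈ seen → walk (c ∷ cs) f all seen ≡ true → walk cs (f ∘ tl) all seen ≡ true
  walk-seen-class c cs f all seen c∈seen w with f (hd root) ∈? seen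
  ... | yes _      = w
  ... | no c∉seen = ⊥-elim (c∉seen c∈seen)

  walk-sound : (cs : List (Tree L)) (f : PosL cs → ℤ) (all seen : List ℤ) →
    walk cs f all seen ≡ true → ∀ i → Represented cs f all seen i
  walk-sound (c ∷ cs) f all seen w = by-head (f (hd root) ∈? seen)
    where
    by-head : Dec (f (hd root) ∈ seen) → ∀ i → Represented (c ∷ cs) f all seen i
    by-head (yes c∈seen) zero = inj₁ c∈seen
    by-head (yes c∈seen) (suc i) with walk-sound cs (f ∘ tl) all seen (walk-seen-class c cs f all seen c∈seen w) i
    ... | inj₁ i∈seen           = inj₁ i∈seen
    ... | inj₂ (k , same , chk) = inj₂ (suc k , same , chk)
    by-head (no c∉seen) zero = inj₂ (zero , refl , proj₁ (walk-new-class c cs f all seen c∉seen w))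
    by-head (no c∉seen) (suc i)
      with walk-sound cs (f ∘ tl) all (f (hd root) ∷ seen) (proj₂ (walk-new-class c cs f all seen c∉seen w)) i
    ... | inj₁ (here same)      = inj₂ (zero , sym same , proj₁ (walk-new-class c cs f all seen c∉seen w))
    ... | inj₁ (there i∈seen)   = inj₁ i∈seen
    ... | inj₂ (k , same , chk) = inj₂ (suc k , same , chk)

  keyed : (ts : List (Tree L)) → (PosL ts → ℤ) → List (Tree L × ℤ)
  keyed []       f = []
  keyed (t ∷ ts) f = (t , f (hd root)) ∷ keyed ts (f ∘ tl)

  map-proj₁-keyed : (ts : List (Tree L)) (f : PosL ts → ℤ) → map proj₁ (keyed ts f) ≡ ts
  map-proj₁-keyed []       f = refl
  map-proj₁-keyed (t ∷ ts) f = cong (t ∷_) (map-proj₁-keyed ts (f ∘ tl))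

  map-proj₂-keyed : (ts : List (Tree L)) (f : PosL ts → ℤ) → map proj₂ (keyed ts f) ≡ childJs ts f
  map-proj₂-keyed []       f = refl
  map-proj₂-keyed (t ∷ ts) f = cong (f (hd root) ∷_) (map-proj₂-keyed ts (f ∘ tl))

  ∈-keyed : (ts : List (Tree L)) (f : PosL ts → ℤ) {x : Tree L × ℤ} → x ∈ keyed ts f →
    ∃[ i ] x ≡ (lookup ts i , f (within i root))
  ∈-keyed (t ∷ ts) f (here x≡)  = zero , x≡
  ∈-keyed (t ∷ ts) f (there x∈) = let (i , x≡) = ∈-keyed ts (f ∘ tl) x∈ in suc i , x≡

  count-childJs : (ts : List (Tree L)) (f : PosL ts → ℤ) (v : ℤ) →
    occ v (childJs ts f) ≡ sum (λ i → indicator (f (within i root)) v)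
  count-childJs []       f v = refl
  count-childJs (t ∷ ts) f v = trans (count-∷ (f (hd root)) (childJs ts (f ∘ tl)))
                                      (cong (indicator (f (hd root)) v +_) (count-childJs ts (f ∘ tl) v))
    where
    count-∷ : ∀ x xs → occ v (x ∷ xs) ≡ indicator x v + occ v xs
    count-∷ x xs with x ℤ.≟ v
    ... | yes _ = refl
    ... | no _  = refl

  non-leaf-size : isLeafTree t ≡ false → 2 ≤ size t
  non-leaf-size {node _ (node _ _ ∷ _)} _ = s≤s (s≤s z≤n)

  NiceAut⇒non-leaf : NiceAut ⟦ t ⟧ → isLeafTree t ≡ false
  NiceAut⇒non-leaf {node _ []}      nice = ⊥-elim (¬NiceAut-leaf nice)
  NiceAut⇒non-leaf {node _ (_ ∷ _)} _    = refl

  NiceAut⇒automorphism : NiceAut ⟦ t ⟧ → Σ (Automorphism t) NiceOnLeaves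
  NiceAut⇒automorphism (σ , σ-nice) = ≅⇒automorphism σ , σ-nice

  automorphism⇒NiceAut : Σ (Automorphism t) NiceOnLeaves → NiceAut ⟦ t ⟧
  automorphism⇒NiceAut (σ , σ-nice) = automorphism⇒≅ σ , σ-nice

  Correct : Tree L → Set
  Correct t = (j : Pos t → ℤ) → 2 ≤ size t → IsJNumbering t j →
    (hasNiceAutomorphism t j ≡ true) ⇔ Σ (Automorphism t) NiceOnLeaves

  module _ {l} {ts : List (Tree L)} (j : Pos (node l ts) → ℤ) (jn : IsJNumbering (node l ts) j)
           (correct-child : ∀ i → Correct (lookup ts i)) where

    private
      js : List ℤ
      js = childJs ts (j ∘ sub)

      child-accepts⇔nice : ∀ i → isLeafTree (lookup ts i) ≡ false →
        (hasNiceAutomorphism (lookup ts i) (j ∘ below i) ≡ true) ⇔ Σ (Automorphism (lookup ts i)) NiceOnLeaves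
      child-accepts⇔nice i non-leaf = correct-child i (j ∘ below i) (non-leaf-size non-leaf) (IsJNumbering-child j jn i)

    odd-class-nice : hasNiceAutomorphism (node l ts) j ≡ true →
      ∀ i → odd (occ (j (below i root)) js) ≡ true → NiceAut ⟦ lookup ts i ⟧
    odd-class-nice accepts i odd-i with walk-sound ts (j ∘ sub) js [] accepts i
    ... | inj₂ (k , same , checked-k) =
      let (non-leaf , accepts-k) = checked-k (trans (cong (λ v → odd (occ v js)) same) odd-i)
      in NiceAut-transport (same-j⇒≅ j jn k i same)
           (automorphism⇒NiceAut (Equivalence.to (child-accepts⇔nice k non-leaf) accepts-k))

    accepts⇒nice : hasNiceAutomorphism (node l ts) j ≡ true → NiceAut ⟦ ts ⟧*
    accepts⇒nice accepts =
      subst (NiceAut ∘ ⟦_⟧*) (map-proj₁-keyed ts (j ∘ sub))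
        (pair-up (length (keyed ts (j ∘ sub))) (keyed ts (j ∘ sub)) ℕ.≤-refl same-key odd-key)
      where
      same-key : SameKeyIsomorphic (keyed ts (j ∘ sub))
      same-key x∈ y∈ same with ∈-keyed ts (j ∘ sub) x∈ | ∈-keyed ts (j ∘ sub) y∈
      ... | w , refl | i , refl = same-j⇒≅ j jn w i same
      odd-key : OddKeyNice (keyed ts (j ∘ sub))
      odd-key x∈ odd-x with ∈-keyed ts (j ∘ sub) x∈
      ... | i , refl = odd-class-nice accepts i
                         (trans (cong (odd ∘ occ (j (below i root))) (sym (map-proj₂-keyed ts (j ∘ sub)))) odd-x)

    -- σ permutes the children by an involution π (σ² fixes the leaves below each child).
    -- If π fixed no child of an odd class, it would split that class into pairs; so some
    -- child of the class is fixed, and σ restricts to a nice automorphism of its subtree.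
    nice⇒accepts : NiceAut ⟦ node l ts ⟧ → hasNiceAutomorphism (node l ts) j ≡ true
    nice⇒accepts (σ , σ-nice) = walk-complete ts (j ∘ sub) js [] checked
      where
      π : Fin (length ts) → Fin (length ts)
      π i = proj₁ (child-image σ i)

      σ-child : ∀ i → to σ (below i root) ≡ below (π i) root
      σ-child i = proj₂ (child-image σ i)

      π-involutive : ∀ i → π (π i) ≡ i
      π-involutive i =
        let (p , p-leaf) = some-leaf (lookup ts i)
            (ψ , σ-below) = restrict σ i (π i) (σ-child i)
            (ψ′ , σ-below′) = restrict σ (π i) (π (π i)) (σ-child (π i))
        in below-index (π (π i)) i (begin
             below (π (π i)) (to ψ′ (to ψ p))  ≡⟨ sym (σ-below′ (to ψ p)) ⟩
             to σ (below (π i) (to ψ p))       ≡⟨ cong (to σ) (sym (σ-below p)) ⟩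
             to σ (to σ (below i p))           ≡⟨ proj₁ (σ-nice (below i p) (below-leaf i p-leaf)) ⟩
             below i p                         ∎)
        where open ≡-Reasoning

      jπ : ∀ i → j (below (π i) root) ≡ j (below i root)
      jπ i = sym (Equivalence.from
        (jn (below i root) (below (π i) root) (trans (depth-child {l} {ts} i) (sym (depth-child {l} {ts} (π i)))))
        (≅⇒automorphism σ , σ-child i))

      fixed-child-nice : ∀ w → π w ≡ w → NiceAut ⟦ lookup ts w ⟧
      fixed-child-nice w π-fixes-w =
        NiceAut-restrict σ σ-nice w (subst (λ k → to σ (below w root) ≡ below k root) π-fixes-w (σ-child w))

      checked : ∀ i → Checked ts (j ∘ sub) js i
      checked i odd-i with Fin.any? (λ w → (j (below w root) ℤ.≟ j (below i root)) ×-dec (π w Fin.≟ w))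
      ... | yes (w , same , fixed) =
        let nice-i = NiceAut-transport (same-j⇒≅ j jn w i same) (fixed-child-nice w fixed)
            non-leaf = NiceAut⇒non-leaf nice-i
        in non-leaf , Equivalence.from (child-accepts⇔nice i non-leaf) (NiceAut⇒automorphism nice-i)
      ... | no no-fixed =
        let (h , even) = involution-fibre-even (λ w → j (below w root)) π π-involutive jπ (j (below i root))
                           (λ w same fixed → no-fixed (w , same , fixed))
        in contradiction (begin
             false                                    ≡⟨ sym (isOdd-double h) ⟩
             odd (h + h)                              ≡⟨ cong odd (sym even) ⟩
             odd (sum (λ w → indicator (j (below w root)) (j (below i root)))) ≡⟨ cong odd (sym (count-childJs ts (j ∘ sub) _)) ⟩
             odd (occ (j (below i root)) js)          ≡⟨ odd-i ⟩
             true                                     ∎) λ ()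
        where open ≡-Reasoning

  correct          : (t : Tree L) → Correct t
  correct-children : (ts : List (Tree L)) (i : Fin (length ts)) → Correct (lookup ts i)

  correct-children (t ∷ ts) zero    = correct t
  correct-children (t ∷ ts) (suc i) = correct-children ts i

  correct (node l [])       j (s≤s ()) jn
  correct (node l (t ∷ ts)) j _        jn = mk⇔
    (NiceAut⇒automorphism ∘ NiceAut-node ∘ accepts⇒nice j jn (correct-children (t ∷ ts)))
    (nice⇒accepts j jn (correct-children (t ∷ ts)) ∘ automorphism⇒NiceAut)

  -- Running time

  childrenCost : (ts : List (Tree L)) → (PosL ts → ℤ) → ℕ
  childrenCost []       f = 0
  childrenCost (t ∷ ts) f = cost t (f ∘ hd) + childrenCost ts (f ∘ tl)

  sumOfSquares : List (Tree L) → ℕ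
  sumOfSquares []       = 0
  sumOfSquares (t ∷ ts) = size t * size t + sumOfSquares ts

  walkCost-step : ∀ {S D A X C R Q} → S ≤ D → X ≤ C + (R + Q) → suc (S + A + X) ≤ C + R + (suc (D + A) + Q)
  walkCost-step {S} {D} {A} {X} {C} {R} {Q} S≤D X≤ = ℕ.≤-trans
    (s≤s (ℕ.+-mono-≤ (ℕ.+-monoˡ-≤ A S≤D) X≤)) (ℕ.≤-reflexive (regroup D A C R Q))
    where
    regroup : ∀ D A C R Q → suc (D + A + (C + (R + Q))) ≡ C + R + (suc (D + A) + Q)
    regroup = solve-∀

  length-childJs : (ts : List (Tree L)) (f : PosL ts → ℤ) → length (childJs ts f) ≡ length ts
  length-childJs []       f = refl
  length-childJs (t ∷ ts) f = cong suc (length-childJs ts (f ∘ tl))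

  -- D bounds the length 'seen' can reach; each of the |cs| + 1 steps scans 'seen' and 'all' once.
  walkCost-bound : (cs : List (Tree L)) (f : PosL cs → ℤ) (all seen : List ℤ) (D : ℕ) →
    length seen + length cs ≤ D →
    walkCost cs f all seen ≤ childrenCost cs f + suc (length cs) * suc (D + length all)
  walkCost-bound []       f all seen D _ = s≤s z≤n
  walkCost-bound (c ∷ cs) f all seen D seen+cs≤D with ⌊ f (hd root) ∈? seen ⌋
  ... | true  = walkCost-step {C = cost c (f ∘ hd)} {R = childrenCost cs (f ∘ tl)}
                  (ℕ.m+n≤o⇒m≤o (length seen) seen+cs≤D)
                  (ℕ.≤-trans (walkCost-bound cs (f ∘ tl) all seen D
                               (ℕ.≤-trans (ℕ.+-monoʳ-≤ (length seen) (ℕ.n≤1+n (length cs))) seen+cs≤D))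
                             (ℕ.m≤n+m _ (cost c (f ∘ hd))))
  ... | false = walkCost-step {C = cost c (f ∘ hd)} {R = childrenCost cs (f ∘ tl)}
                  (ℕ.m+n≤o⇒m≤o (length seen) seen+cs≤D)
                  (ℕ.+-mono-≤ (callCost≤cost (odd (occ (f (hd root)) all)) (isLeafTree c))
                              (walkCost-bound cs (f ∘ tl) all (f (hd root) ∷ seen) D
                                (subst (_≤ D) (ℕ.+-suc (length seen) (length cs)) seen+cs≤D)))
    where
    callCost≤cost : ∀ (odd leaf : Bool) → (if odd then (if leaf then 0 else cost c (f ∘ hd)) else 0) ≤ cost c (f ∘ hd)
    callCost≤cost false _     = z≤n
    callCost≤cost true  true  = z≤n
    callCost≤cost true  false = ℕ.≤-refl

  squares-bound : ∀ y (ts : List (Tree L)) →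
    (suc y + length ts) * (suc y + length ts) + 4 * sumOfSquares ts
      ≤ (suc y + 2 * sizeL ts) * (suc y + 2 * sizeL ts)
  squares-bound y [] = ℕ.≤-reflexive (regroup y)
    where
    regroup : ∀ y → (suc y + 0) * (suc y + 0) + 4 * 0 ≡ (suc y + 2 * 0) * (suc y + 2 * 0)
    regroup = solve-∀
  squares-bound y (node _ cs ∷ ts) = begin
      (suc y + suc d) * (suc y + suc d) + 4 * (suc s * suc s + Sq)
    ≤⟨ ℕ.m≤m+n _ (4 * s * (y + d) + 2 * (y + d) + 4 * s + 1) ⟩
      (suc y + suc d) * (suc y + suc d) + 4 * (suc s * suc s + Sq) + (4 * s * (y + d) + 2 * (y + d) + 4 * s + 1)
    ≡⟨ expand y d s Sq ⟩
      (suc y′ + d) * (suc y′ + d) + 4 * Sq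
    ≤⟨ squares-bound y′ ts ⟩
      (suc y′ + 2 * S) * (suc y′ + 2 * S)
    ≡⟨ regroup y s S ⟩
      (suc y + 2 * (suc s + S)) * (suc y + 2 * (suc s + S))
    ∎
    where
    open ℕ.≤-Reasoning
    d s S Sq y′ : ℕ
    d = length ts
    s = sizeL cs
    S = sizeL ts
    Sq = sumOfSquares ts
    y′ = y + 2 * suc s
    expand : ∀ y d s Sq →
      (suc y + suc d) * (suc y + suc d) + 4 * (suc s * suc s + Sq) + (4 * s * (y + d) + 2 * (y + d) + 4 * s + 1)
        ≡ (suc (y + 2 * suc s) + d) * (suc (y + 2 * suc s) + d) + 4 * Sq
    expand = solve-∀
    regroup : ∀ y s S → (suc (y + 2 * suc s) + 2 * S) * (suc (y + 2 * suc s) + 2 * S)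
                        ≡ (suc y + 2 * (suc s + S)) * (suc y + 2 * (suc s + S))
    regroup = solve-∀

  cost-bound         : (t : Tree L) (j : Pos t → ℤ) → cost t j ≤ 8 * (size t * size t)
  childrenCost-bound : (ts : List (Tree L)) (f : PosL ts → ℤ) → childrenCost ts f ≤ 8 * sumOfSquares ts

  childrenCost-bound []       f = z≤n
  childrenCost-bound (t ∷ ts) f = ℕ.≤-trans
    (ℕ.+-mono-≤ (cost-bound t (f ∘ hd)) (childrenCost-bound ts (f ∘ tl)))
    (ℕ.≤-reflexive (sym (ℕ.*-distribˡ-+ 8 (size t * size t) (sumOfSquares ts))))

  cost-bound (node _ ts) j = begin
      suc (d + walkCost ts jₛ (childJs ts jₛ) [])
    ≤⟨ s≤s (ℕ.+-monoʳ-≤ d (walkCost-bound ts jₛ (childJs ts jₛ) [] d ℕ.≤-refl)) ⟩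
      suc (d + (childrenCost ts jₛ + suc d * suc (d + length (childJs ts jₛ))))
    ≡⟨ cong (λ a → suc (d + (childrenCost ts jₛ + suc d * suc (d + a)))) (length-childJs ts jₛ) ⟩
      suc (d + (childrenCost ts jₛ + suc d * suc (d + d)))
    ≤⟨ s≤s (ℕ.+-monoʳ-≤ d (ℕ.+-monoˡ-≤ _ (childrenCost-bound ts jₛ))) ⟩
      suc (d + (8 * Sq + suc d * suc (d + d)))
    ≡⟨ regroup d Sq ⟩
      2 * (suc d * suc d + 4 * Sq)
    ≤⟨ ℕ.*-monoʳ-≤ 2 (squares-bound 0 ts) ⟩
      2 * (suc (2 * S) * suc (2 * S))
    ≤⟨ ℕ.m≤m+n _ (6 + 8 * S) ⟩
      2 * (suc (2 * S) * suc (2 * S)) + (6 + 8 * S)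
    ≡⟨ expand S ⟩
      8 * (suc S * suc S)
    ∎
    where
    open ℕ.≤-Reasoning
    d Sq S : ℕ
    d = length ts
    Sq = sumOfSquares ts
    S = sizeL ts
    jₛ : PosL ts → ℤ
    jₛ = j ∘ sub
    regroup : ∀ d Sq → suc (d + (8 * Sq + suc d * suc (d + d))) ≡ 2 * (suc d * suc d + 4 * Sq)
    regroup = solve-∀
    expand : ∀ S → 2 * (suc (2 * S) * suc (2 * S)) + (6 + 8 * S) ≡ 8 * (suc S * suc S)
    expand = solve-∀

  cost-quadratic : (t : Tree L) (j : Pos t → ℤ) → cost t j ≤ 8 * size t ^ 2
  cost-quadratic t j = ℕ.≤-trans (cost-bound t j)
    (ℕ.≤-reflexive (cong (λ n → 8 * (size t * n)) (sym (ℕ.*-identityʳ (size t)))))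

lemma5p8 : (∀ {L : Set} (t : Tree L) (j : Pos t → ℤ) → 2 ≤ size t → IsJNumbering t j →
    (hasNiceAutomorphism t j ≡ true) ⇔ Σ (Automorphism t) NiceOnLeaves)
    × (∃[ C ] (∀ {L : Set} (t : Tree L) (j : Pos t → ℤ) → 2 ≤ size t → IsJNumbering t j →
    cost t j ≤ C * size t ^ 2))
lemma5p8 = correct , (8 , λ t j _ _ → cost-quadratic t j)
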